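{- For each $n \geq 2$ and each $n$-vertex graph $G$ with at least one edge, \[ q^*(G) \leq \frac{2\left(\binom{n}{2} - \frac{n}{2} - e(G)\right)^+}{e(G)}, \] where $x^+=\max\{x,0\}$.
   Context: Graphs are finite and simple; $e(G)$ is the number of edges. For a graph $G=(V,E)$ with $m \geq 1$ edges and degrees $d_v$, for $A\subseteq V$ let ${\rm vol}(A)=\sum_{v\in A} d_v$ and let $e(A)$ be the number of edges with both ends in $A$. For a partition $\mathcal{A}$ of $V$, $q_{\mathcal A}(G)=\frac{1}{m}\sum_{A\in\mathcal A} e(A)-\frac{1}{4m^2}\sum_{A\in\mathcal A}{\rm vol}(A)^2$, and $q^*(G)=\max_{\mathcal A} q_{\mathcal A}(G)$. -}

module Defs where

open import Data.Bool using (Bool; true; false; if_then_else_)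
open import Data.Nat using (ℕ; zero; suc; _<ᵇ_)
import Data.Nat as ℕ
open import Data.Nat.Combinatorics using (_C_)
open import Data.Fin using (Fin; toℕ)
open import Data.List using (List; map; allFin)
open import Data.Nat.ListAction using (sum)
open import Data.Integer using (+_)
open import Data.Rational using (ℚ; 0ℚ; _/_; _+_; _-_; _*_; _⊔_)
open import Relation.Binary.PropositionalEquality using (_≡_)

record Graph (n : ℕ) : Set where
  field
    adj    : Fin n → Fin n → Bool
    sym    : ∀ u v → adj u v ≡ adj v u
    irrefl : ∀ v → adj v v ≡ false
open Graph public

Σ[_] : (n : ℕ) → (Fin n → ℕ) → ℕ
Σ[ n ] f = sum (map f (allFin n))

indicator : Bool → ℕ
indicator b = if b then 1 else 0

edges : ∀ {n} → Graph n → ℕ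
edges {n} G = Σ[ n ] λ i → Σ[ n ] λ j → indicator (toℕ i <ᵇ toℕ j) ℕ.* indicator (adj G i j)

degree : ∀ {n} → Graph n → Fin n → ℕ
degree {n} G v = Σ[ n ] λ u → indicator (adj G v u)

-- A partition of the vertex set is given by a labelling f : Fin n → Fin n
-- (block k = f⁻¹(k)); every partition arises this way, and empty blocks
-- contribute 0 to every sum below.
Partition : ℕ → Set
Partition n = Fin n → Fin n

eqᵇ : ∀ {n} → Fin n → Fin n → Bool
eqᵇ i j = Data.Nat._≡ᵇ_ (toℕ i) (toℕ j)

blockEdges : ∀ {n} → Graph n → Partition n → Fin n → ℕ
blockEdges {n} G f k = Σ[ n ] λ i → Σ[ n ] λ j →
  indicator (toℕ i <ᵇ toℕ j) ℕ.* indicator (adj G i j)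
    ℕ.* indicator (eqᵇ (f i) k) ℕ.* indicator (eqᵇ (f j) k)

vol : ∀ {n} → Graph n → Partition n → Fin n → ℕ
vol {n} G f k = Σ[ n ] λ v → indicator (eqᵇ (f v) k) ℕ.* degree G v

ℕ→ℚ : ℕ → ℚ
ℕ→ℚ k = + k / 1

-- 1/k for k ≥ 1 (value at 0 is irrelevant: only used with k = e(G) ≥ 1)
inv : ℕ → ℚ
inv zero    = 0ℚ
inv (suc k) = + 1 / suc k

modularity : ∀ {n} → Graph n → Partition n → ℚ
modularity {n} G f =
  inv m * ℕ→ℚ (Σ[ n ] λ k → blockEdges G f k)
  - inv (4 ℕ.* m ℕ.* m) * ℕ→ℚ (Σ[ n ] λ k → vol G f k ℕ.* vol G f k)
  where m = edges G

-- q*(G) ≤ x  :⇔  q_A(G) ≤ x for every partition A (q* is the maximum over partitions)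
q*≤ : ∀ {n} → Graph n → ℚ → Set
q*≤ {n} G x = (f : Partition n) → modularity G f Data.Rational.≤ x

_⁺ : ℚ → ℚ
x ⁺ = x ⊔ 0ℚ

bound : ∀ {n} → Graph n → ℚ
bound {n} G = ℕ→ℚ 2 * ((ℕ→ℚ (n C 2) - (+ n / 2) - ℕ→ℚ (edges G)) ⁺) * inv (edges G)

module Submission where

-- For a block A of the partition let a = |A|, b = n − a, p = 2e(A), q = 2e(V∖A), c = e(A, V∖A),
-- and let d be the number of non-adjacent pairs between A and V∖A.  Then vol(A) = p + c,
-- 2m = p + q + 2c, c + d = ab, p ≤ a² − a and q ≤ b² − b, and from these alone
-- 4pq ≤ (2ab − a − b)² ≤ (2c + (2d − n)⁺)², which implies
-- 2m·p ≤ vol(A)² + 2m·(2d − n)⁺.  Summing over the blocks, and writing ē = C(n,2) − m for the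
-- number of edges of the complement, every 2d is at most 2ē and the d's add up to at most 2ē;
-- as (x − n)⁺ ≤ x(2ē − n)⁺/(2ē) for 0 ≤ x ≤ 2ē, the sum of the (2d − n)⁺ is at most
-- 2(2ē − n)⁺.  Dividing by 4m² gives q_𝒜(G) ≤ (2ē − n)⁺/m, which is the claimed bound.

open import Defs hiding (sym)
open import Data.Bool using (Bool; true; false; not; T; _∨_)
open import Data.Fin using (Fin; toℕ; zero; suc)
open import Data.Fin.Properties using (toℕ-injective)
import Data.Integer as ℤ
import Data.Integer.Properties as ℤP
open import Data.List using (tabulate)
open import Data.List.Properties using (map-tabulate)
open import Data.Nat
open import Data.Nat.Combinatorics using (_C_; nC1≡n; nCk+nC[k+1]≡[n+1]C[k+1])
open import Data.Nat.ListAction using () renaming (sum to sumˡ)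
open import Data.Nat.Properties
open import Algebra.Properties.Semiring.Sum +-*-semiring
  using (sum; sum-cong-≗; sum-replicate-zero; ∑-distrib-+; ∑-comm; *-distribˡ-sum; *-distribʳ-sum)
open import Data.Nat.Tactic.RingSolver using (solve-∀)
open import Data.Product using (_,_)
import Data.Rational as ℚ
import Data.Rational.Properties as ℚP
open import Data.Rational.Solver using (module +-*-Solver)
import Data.Rational.Unnormalised as ℚᵘ
import Data.Rational.Unnormalised.Properties as ℚᵘP
open import Data.Sum using ([_,_]′)
open import Function using (_∘_; id)
open import Relation.Binary.PropositionalEquality

-- Arithmetic on ℕ

m+m≡2*m : ∀ m → m + m ≡ 2 * m
m+m≡2*m m = cong (m +_) (sym (+-identityʳ m))

m*n≤m : ∀ m {n} → n ≤ 1 → m * n ≤ m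
m*n≤m m n≤1 = ≤-trans (*-monoʳ-≤ m n≤1) (≤-reflexive (*-identityʳ m))

2*nC2+n≡n*n : ∀ n → 2 * (n C 2) + n ≡ n * n
2*nC2+n≡n*n zero    = refl
2*nC2+n≡n*n (suc n) = begin
  2 * (suc n C 2) + suc n         ≡⟨ cong (λ c → 2 * c + suc n) (nCk+nC[k+1]≡[n+1]C[k+1] n 1) ⟨
  2 * (n C 1 + n C 2) + suc n     ≡⟨ cong (λ c → 2 * (c + n C 2) + suc n) (nC1≡n n) ⟩
  2 * (n + n C 2) + suc n         ≡⟨ regroup n (n C 2) ⟩
  (2 * (n C 2) + n) + (2 * n + 1) ≡⟨ cong (_+ (2 * n + 1)) (2*nC2+n≡n*n n) ⟩
  n * n + (2 * n + 1)             ≡⟨ square n ⟩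
  suc n * suc n                   ∎
  where
  open ≡-Reasoning
  regroup : ∀ n c → 2 * (n + c) + suc n ≡ (2 * c + n) + (2 * n + 1)
  regroup = solve-∀
  square : ∀ n → n * n + (2 * n + 1) ≡ suc n * suc n
  square = solve-∀

2*[m*n]≤m*m+n*n : ∀ m n → 2 * (m * n) ≤ m * m + n * n
2*[m*n]≤m*m+n*n m n = [ ordered , swapped ]′ (≤-total m n)
  where
  ordered : ∀ {m n} → m ≤ n → 2 * (m * n) ≤ m * m + n * n
  ordered {m} m≤n with m≤n⇒∃[o]m+o≡n m≤n
  ... | o , refl = ≤-trans (m≤m+n _ (o * o)) (≤-reflexive (identity m o))
    where
    identity : ∀ m o → 2 * (m * (m + o)) + o * o ≡ m * m + (m + o) * (m + o)
    identity = solve-∀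
  swapped : n ≤ m → 2 * (m * n) ≤ m * m + n * n
  swapped n≤m = subst₂ _≤_ (cong (2 *_) (*-comm n m)) (+-comm (n * n) (m * m)) (ordered n≤m)

4*[m*n]≤[m+n]*[m+n] : ∀ m n → 4 * (m * n) ≤ (m + n) * (m + n)
4*[m*n]≤[m+n]*[m+n] m n =
  subst₂ _≤_ (double (m * n)) (square m n) (+-monoʳ-≤ (2 * (m * n)) (2*[m*n]≤m*m+n*n m n))
  where
  double : ∀ x → 2 * x + 2 * x ≡ 4 * x
  double = solve-∀
  square : ∀ m n → 2 * (m * n) + (m * m + n * n) ≡ (m + n) * (m + n)
  square = solve-∀

oblong*oblong-bound : ∀ x y → 4 * ((x * suc x) * (y * suc y)) ≤ (2 * (x * y) + x + y) * (2 * (x * y) + x + y)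
oblong*oblong-bound x y = +-cancelʳ-≤ (x * x + y * y) _ _ (begin
  4 * ((x * suc x) * (y * suc y)) + (x * x + y * y) ≡⟨ identity x y ⟩
  w * w + 2 * (x * y)                               ≤⟨ +-monoʳ-≤ (w * w) (2*[m*n]≤m*m+n*n x y) ⟩
  w * w + (x * x + y * y)                           ∎)
  where
  open ≤-Reasoning
  w : ℕ
  w = 2 * (x * y) + x + y
  identity : ∀ x y → 4 * ((x * suc x) * (y * suc y)) + (x * x + y * y)
                     ≡ (2 * (x * y) + x + y) * (2 * (x * y) + x + y) + 2 * (x * y)
  identity = solve-∀

4*[p*q]≤w*w : ∀ {a b p q} w → p + a ≤ a * a → q + b ≤ b * b → 2 * (a * b) ≤ w + (a + b) →
              4 * (p * q) ≤ w * w
4*[p*q]≤w*w {zero}  {_}     {p}     _ p+0≤0 _ _ rewrite n≤0⇒n≡0 (≤-trans (m≤m+n p 0) p+0≤0) = z≤n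
4*[p*q]≤w*w {suc _} {zero}  {p} {q} _ _ q+0≤0 _ rewrite n≤0⇒n≡0 (≤-trans (m≤m+n q 0) q+0≤0) | *-zeroʳ p = z≤n
4*[p*q]≤w*w {suc x} {suc y} {p} {q} w p-bound q-bound 2ab≤w+a+b = begin
  4 * (p * q)                                   ≤⟨ *-monoʳ-≤ 4 (*-mono-≤ (oblong p-bound) (oblong q-bound)) ⟩
  4 * ((x * suc x) * (y * suc y))               ≤⟨ oblong*oblong-bound x y ⟩
  (2 * (x * y) + x + y) * (2 * (x * y) + x + y) ≤⟨ *-mono-≤ w₀≤w w₀≤w ⟩
  w * w                                         ∎
  where
  open ≤-Reasoning
  oblong : ∀ {z r} → r + suc z ≤ suc z * suc z → r ≤ z * suc z
  oblong {z} {r} r-bound =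
    +-cancelʳ-≤ (suc z) r (z * suc z) (subst (r + suc z ≤_) (+-comm (suc z) (z * suc z)) r-bound)
  identity : ∀ x y → (2 * (x * y) + x + y) + (suc x + suc y) ≡ 2 * (suc x * suc y)
  identity = solve-∀
  w₀≤w : 2 * (x * y) + x + y ≤ w
  w₀≤w = +-cancelʳ-≤ (suc x + suc y) _ w (subst (_≤ w + (suc x + suc y)) (sym (identity x y)) 2ab≤w+a+b)

p*q≤c*c+[p+q+2c]*k : ∀ p q c k → 4 * (p * q) ≤ (2 * c + k) * (2 * c + k) →
                     p * q ≤ c * c + (p + q + 2 * c) * k
p*q≤c*c+[p+q+2c]*k p q c k 4pq≤[2c+k]² = *-cancelˡ-≤ 4 ([ small-k , large-k ]′ (≤-total k (p + q)))
  where
  open ≤-Reasoning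
  square : ∀ c k → (2 * c + k) * (2 * c + k) ≡ 4 * (c * c) + 4 * (c * k) + k * k
  square = solve-∀
  expand₁ : ∀ p q c k → 4 * (c * c) + 4 * (c * k) + k * (p + q) + (4 * (c * k) + 3 * (k * (p + q)))
                        ≡ 4 * (c * c + (p + q + 2 * c) * k)
  expand₁ = solve-∀
  expand₂ : ∀ p q c k → (p + q) * k + (4 * (c * c) + 3 * ((p + q) * k) + 8 * (c * k))
                        ≡ 4 * (c * c + (p + q + 2 * c) * k)
  expand₂ = solve-∀
  small-k : k ≤ p + q → 4 * (p * q) ≤ 4 * (c * c + (p + q + 2 * c) * k)
  small-k k≤p+q = begin
    4 * (p * q)                                ≤⟨ 4pq≤[2c+k]² ⟩
    (2 * c + k) * (2 * c + k)                  ≡⟨ square c k ⟩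
    4 * (c * c) + 4 * (c * k) + k * k          ≤⟨ +-monoʳ-≤ (4 * (c * c) + 4 * (c * k)) (*-monoʳ-≤ k k≤p+q) ⟩
    4 * (c * c) + 4 * (c * k) + k * (p + q)    ≤⟨ m≤m+n _ (4 * (c * k) + 3 * (k * (p + q))) ⟩
    4 * (c * c) + 4 * (c * k) + k * (p + q) + (4 * (c * k) + 3 * (k * (p + q)))
                                               ≡⟨ expand₁ p q c k ⟩
    4 * (c * c + (p + q + 2 * c) * k)          ∎
  large-k : p + q ≤ k → 4 * (p * q) ≤ 4 * (c * c + (p + q + 2 * c) * k)
  large-k p+q≤k = begin
    4 * (p * q)                                ≤⟨ 4*[m*n]≤[m+n]*[m+n] p q ⟩
    (p + q) * (p + q)                          ≤⟨ *-monoʳ-≤ (p + q) p+q≤k ⟩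
    (p + q) * k                                ≤⟨ m≤m+n _ (4 * (c * c) + 3 * ((p + q) * k) + 8 * (c * k)) ⟩
    (p + q) * k + (4 * (c * c) + 3 * ((p + q) * k) + 8 * (c * k))
                                               ≡⟨ expand₂ p q c k ⟩
    4 * (c * c + (p + q + 2 * c) * k)          ∎

cut-inequality : ∀ {a b p q c d} → p + a ≤ a * a → q + b ≤ b * b → c + d ≡ a * b →
                 (p + q + 2 * c) * p ≤ (p + c) * (p + c) + (p + q + 2 * c) * (2 * d ∸ (a + b))
cut-inequality {a} {b} {p} {q} {c} {d} p-bound q-bound c+d≡ab = +-cancelʳ-≤ (c * c) _ _ (begin
  M * p + c * c                       ≡⟨ identity p q c ⟩
  (p + c) * (p + c) + p * q           ≤⟨ +-monoʳ-≤ ((p + c) * (p + c)) (p*q≤c*c+[p+q+2c]*k p q c k 4pq≤[2c+k]²) ⟩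
  (p + c) * (p + c) + (c * c + M * k) ≡⟨ regroup ((p + c) * (p + c)) (c * c) (M * k) ⟩
  (p + c) * (p + c) + M * k + c * c   ∎)
  where
  open ≤-Reasoning
  M k : ℕ
  M = p + q + 2 * c
  k = 2 * d ∸ (a + b)
  identity : ∀ p q c → (p + q + 2 * c) * p + c * c ≡ (p + c) * (p + c) + p * q
  identity = solve-∀
  regroup : ∀ x y z → x + (y + z) ≡ x + z + y
  regroup = solve-∀
  2ab≤2c+k+a+b : 2 * (a * b) ≤ (2 * c + k) + (a + b)
  2ab≤2c+k+a+b = begin
    2 * (a * b)                   ≡⟨ cong (2 *_) c+d≡ab ⟨
    2 * (c + d)                   ≡⟨ *-distribˡ-+ 2 c d ⟩
    2 * c + 2 * d                 ≤⟨ +-monoʳ-≤ (2 * c) (m≤n+m∸n (2 * d) (a + b)) ⟩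
    2 * c + ((a + b) + k)         ≡⟨ cong (2 * c +_) (+-comm (a + b) k) ⟩
    2 * c + (k + (a + b))         ≡⟨ +-assoc (2 * c) k (a + b) ⟨
    2 * c + k + (a + b)           ∎
  4pq≤[2c+k]² : 4 * (p * q) ≤ (2 * c + k) * (2 * c + k)
  4pq≤[2c+k]² = 4*[p*q]≤w*w {a} {b} {p} {q} (2 * c + k) p-bound q-bound 2ab≤2c+k+a+b

[x∸m]*T≤x*[T∸m] : ∀ {x T} m → x ≤ T → (x ∸ m) * T ≤ x * (T ∸ m)
[x∸m]*T≤x*[T∸m] {x} {T} m x≤T = begin
  (x ∸ m) * T      ≡⟨ *-distribʳ-∸ T x m ⟩
  x * T ∸ m * T    ≤⟨ ∸-monoʳ-≤ (x * T) (≤-trans (*-monoˡ-≤ m x≤T) (≤-reflexive (*-comm T m))) ⟩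
  x * T ∸ x * m    ≡⟨ *-distribˡ-∸ x T m ⟨
  x * (T ∸ m)      ∎
  where open ≤-Reasoning

-- Finite sums

Σ≡∑ : ∀ n (f : Fin n → ℕ) → Σ[ n ] f ≡ sum f
Σ≡∑ n f = trans (cong sumˡ (map-tabulate id f)) (sum-tabulate n f)
  where
  sum-tabulate : ∀ n (f : Fin n → ℕ) → sumˡ (tabulate f) ≡ sum f
  sum-tabulate zero    f = refl
  sum-tabulate (suc n) f = cong (f zero +_) (sum-tabulate n (f ∘ suc))

∑-mono-≤ : ∀ {n} {f g : Fin n → ℕ} → (∀ i → f i ≤ g i) → sum f ≤ sum g
∑-mono-≤ {zero}  f≤g = z≤n
∑-mono-≤ {suc n} f≤g = +-mono-≤ (f≤g zero) (∑-mono-≤ (f≤g ∘ suc))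

∑-const : ∀ n c → sum {n} (λ _ → c) ≡ n * c
∑-const zero    c = refl
∑-const (suc n) c = cong (c +_) (∑-const n c)

∑-∸-bound : ∀ {N} (x : Fin N → ℕ) {T c} m → (∀ k → x k ≤ T) → sum x ≤ c * T →
            sum (λ k → x k ∸ m) ≤ c * (T ∸ m)
∑-∸-bound {N} x {zero} {c} m x≤0 _ = ≤-reflexive (begin
  sum (λ k → x k ∸ m)   ≡⟨ sum-cong-≗ (λ k → cong (_∸ m) (n≤0⇒n≡0 (x≤0 k))) ⟩
  sum {N} (λ _ → 0 ∸ m) ≡⟨ sum-cong-≗ {N} (λ _ → 0∸n≡0 m) ⟩
  sum {N} (λ _ → 0)     ≡⟨ sum-replicate-zero N ⟩
  0                     ≡⟨ *-zeroʳ c ⟨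
  c * 0                 ≡⟨ cong (c *_) (0∸n≡0 m) ⟨
  c * (0 ∸ m)           ∎)
  where open ≡-Reasoning
∑-∸-bound x {T@(suc _)} {c} m x≤T ∑x≤cT = *-cancelʳ-≤ _ _ T (begin
  sum (λ k → x k ∸ m) * T         ≡⟨ *-distribʳ-sum T (λ k → x k ∸ m) ⟩
  sum (λ k → (x k ∸ m) * T)       ≤⟨ ∑-mono-≤ (λ k → [x∸m]*T≤x*[T∸m] m (x≤T k)) ⟩
  sum (λ k → x k * (T ∸ m))       ≡⟨ *-distribʳ-sum (T ∸ m) x ⟨
  sum x * (T ∸ m)                 ≤⟨ *-monoˡ-≤ (T ∸ m) ∑x≤cT ⟩
  c * T * (T ∸ m)                 ≡⟨ regroup c T (T ∸ m) ⟩
  c * (T ∸ m) * T                 ∎)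
  where
  open ≤-Reasoning
  regroup : ∀ c T U → c * T * U ≡ c * U * T
  regroup = solve-∀

sum² : ∀ {n} → (Fin n → Fin n → ℕ) → ℕ
sum² g = sum λ i → sum (g i)

Σ²≡sum² : ∀ n (g : Fin n → Fin n → ℕ) → Σ[ n ] (λ i → Σ[ n ] (g i)) ≡ sum² g
Σ²≡sum² n g = trans (Σ≡∑ n _) (sum-cong-≗ (λ i → Σ≡∑ n (g i)))

sum²-cong : ∀ {n} {g h : Fin n → Fin n → ℕ} → (∀ i j → g i j ≡ h i j) → sum² g ≡ sum² h
sum²-cong g≗h = sum-cong-≗ (λ i → sum-cong-≗ (g≗h i))

sum²-mono-≤ : ∀ {n} {g h : Fin n → Fin n → ℕ} → (∀ i j → g i j ≤ h i j) → sum² g ≤ sum² h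
sum²-mono-≤ g≤h = ∑-mono-≤ (λ i → ∑-mono-≤ (g≤h i))

sum²-distrib-+ : ∀ {n} (g h : Fin n → Fin n → ℕ) → sum² (λ i j → g i j + h i j) ≡ sum² g + sum² h
sum²-distrib-+ g h = trans (sum-cong-≗ (λ i → ∑-distrib-+ (g i) (h i))) (∑-distrib-+ (sum ∘ g) (sum ∘ h))

sum²-transpose : ∀ {n} (g : Fin n → Fin n → ℕ) → sum² g ≡ sum² (λ i j → g j i)
sum²-transpose = ∑-comm

∑-*-∑ : ∀ {n} (f g : Fin n → ℕ) → sum f * sum g ≡ sum² λ i j → f i * g j
∑-*-∑ f g = trans (*-distribʳ-sum (sum g) f) (sum-cong-≗ (λ i → *-distribˡ-sum (f i) g))

δ : ∀ {n} → Fin n → Fin n → ℕ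
δ i j = indicator (eqᵇ i j)

δ< : ∀ {n} → Fin n → Fin n → ℕ
δ< i j = indicator (toℕ i <ᵇ toℕ j)

eqᵇ⇒≡ : ∀ {n} {i j : Fin n} → eqᵇ i j ≡ true → i ≡ j
eqᵇ⇒≡ {i = i} {j} e = toℕ-injective (≡ᵇ⇒≡ (toℕ i) (toℕ j) (subst T (sym e) _))

≡ᵇ-refl : ∀ a → (a ≡ᵇ a) ≡ true
≡ᵇ-refl zero    = refl
≡ᵇ-refl (suc a) = ≡ᵇ-refl a

≡ᵇ-sym : ∀ a b → (a ≡ᵇ b) ≡ (b ≡ᵇ a)
≡ᵇ-sym zero    zero    = refl
≡ᵇ-sym zero    (suc b) = refl
≡ᵇ-sym (suc a) zero    = refl
≡ᵇ-sym (suc a) (suc b) = ≡ᵇ-sym a b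

∑-δ : ∀ {n} (i : Fin n) (h : Fin n → ℕ) → sum (λ j → δ i j * h j) ≡ h i
∑-δ {suc n} zero h = begin
  h zero + 0 + sum {n} (λ _ → 0) ≡⟨ cong (h zero + 0 +_) (sum-replicate-zero n) ⟩
  h zero + 0 + 0                  ≡⟨ cong (_+ 0) (+-identityʳ (h zero)) ⟩
  h zero + 0                      ≡⟨ +-identityʳ (h zero) ⟩
  h zero                          ∎
  where open ≡-Reasoning
∑-δ {suc n} (suc i) h = ∑-δ i (h ∘ suc)

δ<+δ>+δ≡1 : ∀ {n} (i j : Fin n) → δ< i j + δ< j i + δ i j ≡ 1
δ<+δ>+δ≡1 i j = trichotomy (toℕ i) (toℕ j)
  where
  trichotomy : ∀ a b → indicator (a <ᵇ b) + indicator (b <ᵇ a) + indicator (a ≡ᵇ b) ≡ 1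
  trichotomy zero    zero    = refl
  trichotomy zero    (suc b) = refl
  trichotomy (suc a) zero    = refl
  trichotomy (suc a) (suc b) = trichotomy a b

δ*hollow≡0 : ∀ {n} {g : Fin n → Fin n → ℕ} → (∀ i → g i i ≡ 0) → ∀ i j → δ i j * g i j ≡ 0
δ*hollow≡0 g-hollow i j with eqᵇ i j in e
... | false = refl
... | true with eqᵇ⇒≡ {i = i} {j} e
...   | refl = cong (_+ 0) (g-hollow i)

sum²≡2*sum²< : ∀ {n} (g : Fin n → Fin n → ℕ) → (∀ i j → g i j ≡ g j i) → (∀ i → g i i ≡ 0) →
               sum² g ≡ 2 * sum² (λ i j → δ< i j * g i j)
sum²≡2*sum²< {n} g g-sym g-hollow = begin
  sum² g                          ≡⟨ sum²-cong split ⟩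
  sum² (λ i j → g< i j + g> i j)  ≡⟨ sum²-distrib-+ g< g> ⟩
  sum² g< + sum² g>               ≡⟨ cong (sum² g< +_) (sum²-transpose g>) ⟩
  sum² g< + sum² (λ i j → g> j i) ≡⟨ cong (sum² g< +_) (sum²-cong (λ i j → cong (δ< i j *_) (g-sym j i))) ⟩
  sum² g< + sum² g<               ≡⟨ m+m≡2*m (sum² g<) ⟩
  2 * sum² g<                     ∎
  where
  open ≡-Reasoning
  g< g> : Fin n → Fin n → ℕ
  g< i j = δ< i j * g i j
  g> i j = δ< j i * g i j
  distrib : ∀ a b c x → (a + b + c) * x ≡ a * x + b * x + c * x
  distrib = solve-∀
  split : ∀ i j → g i j ≡ g< i j + g> i j
  split i j = begin
    g i j                                   ≡⟨ *-identityˡ (g i j) ⟨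
    1 * g i j                               ≡⟨ cong (_* g i j) (δ<+δ>+δ≡1 i j) ⟨
    (δ< i j + δ< j i + δ i j) * g i j       ≡⟨ distrib (δ< i j) (δ< j i) (δ i j) (g i j) ⟩
    g< i j + g> i j + δ i j * g i j         ≡⟨ cong (g< i j + g> i j +_) (δ*hollow≡0 g-hollow i j) ⟩
    g< i j + g> i j + 0                     ≡⟨ +-identityʳ (g< i j + g> i j) ⟩
    g< i j + g> i j                         ∎

-- Vertex sets and arcs of a graph

χ : ∀ {n} → (Fin n → Bool) → Fin n → ℕ
χ X i = indicator (X i)

∁ : ∀ {n} → (Fin n → Bool) → Fin n → Bool
∁ X = not ∘ X

size : ∀ {n} → (Fin n → Bool) → ℕ
size X = sum (χ X)

indicator+indicator-not : ∀ b → indicator b + indicator (not b) ≡ 1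
indicator+indicator-not true  = refl
indicator+indicator-not false = refl

χ+χ∁≡1 : ∀ {n} (X : Fin n → Bool) i → χ X i + χ (∁ X) i ≡ 1
χ+χ∁≡1 X i = indicator+indicator-not (X i)

χ≤1 : ∀ {n} (X : Fin n → Bool) i → χ X i ≤ 1
χ≤1 X i = m+n≤o⇒m≤o (χ X i) (≤-reflexive (χ+χ∁≡1 X i))

χ*χ≡χ : ∀ {n} (X : Fin n → Bool) i → χ X i * χ X i ≡ χ X i
χ*χ≡χ X i with X i
... | true  = refl
... | false = refl

size+size∁≡n : ∀ {n} (X : Fin n → Bool) → size X + size (∁ X) ≡ n
size+size∁≡n {n} X = begin
  size X + size (∁ X)           ≡⟨ ∑-distrib-+ (χ X) (χ (∁ X)) ⟨
  sum (λ i → χ X i + χ (∁ X) i) ≡⟨ sum-cong-≗ (χ+χ∁≡1 X) ⟩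
  sum {n} (λ _ → 1)             ≡⟨ ∑-const n 1 ⟩
  n * 1                         ≡⟨ *-identityʳ n ⟩
  n                             ∎
  where open ≡-Reasoning

arc : ∀ {n} → Graph n → Fin n → Fin n → ℕ
arc G i j = indicator (adj G i j)

arc-sym : ∀ {n} (G : Graph n) i j → arc G i j ≡ arc G j i
arc-sym G i j = cong indicator (Graph.sym G i j)

arc-irrefl : ∀ {n} (G : Graph n) i → arc G i i ≡ 0
arc-irrefl G i = cong indicator (irrefl G i)

eqᵇ⇒¬adj : ∀ {n} (G : Graph n) {i j} → eqᵇ i j ≡ true → adj G i j ≡ false
eqᵇ⇒¬adj G {i} e with eqᵇ⇒≡ {i = i} e
... | refl = irrefl G i

-- Ordered pairs are counted: allArcs G = 2e(G), arcs G X X = 2e(X) and arcs G X (∁ X) = e(X, ∁ X).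

allArcs : ∀ {n} → Graph n → ℕ
allArcs G = sum² (arc G)

arcs : ∀ {n} → Graph n → (Fin n → Bool) → (Fin n → Bool) → ℕ
arcs G X Y = sum² λ i j → χ X i * χ Y j * arc G i j

volume : ∀ {n} → Graph n → (Fin n → Bool) → ℕ
volume G X = sum λ i → χ X i * degree G i

2*edges≡allArcs : ∀ {n} (G : Graph n) → 2 * edges G ≡ allArcs G
2*edges≡allArcs {n} G = begin
  2 * edges G                                ≡⟨ cong (2 *_) (Σ²≡sum² n _) ⟩
  2 * sum² (λ i j → δ< i j * arc G i j)      ≡⟨ sum²≡2*sum²< (arc G) (arc-sym G) (arc-irrefl G) ⟨
  allArcs G                                  ∎
  where open ≡-Reasoning

arcs-sym : ∀ {n} (G : Graph n) X Y → arcs G X Y ≡ arcs G Y X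
arcs-sym G X Y = trans (sum²-transpose λ i j → χ X i * χ Y j * arc G i j) (sum²-cong swap)
  where
  swap : ∀ i j → χ X j * χ Y i * arc G j i ≡ χ Y i * χ X j * arc G i j
  swap i j = cong₂ _*_ (*-comm (χ X j) (χ Y i)) (arc-sym G j i)

arcs+arcs∁≡volume : ∀ {n} (G : Graph n) X Y → arcs G X Y + arcs G X (∁ Y) ≡ volume G X
arcs+arcs∁≡volume {n} G X Y = begin
  arcs G X Y + arcs G X (∁ Y)                 ≡⟨ sum²-distrib-+ (term Y) (term (∁ Y)) ⟨
  sum² (λ i j → term Y i j + term (∁ Y) i j)  ≡⟨ sum²-cong split ⟩
  sum² (λ i j → χ X i * arc G i j)            ≡⟨ sum-cong-≗ (λ i → *-distribˡ-sum (χ X i) (arc G i)) ⟨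
  sum (λ i → χ X i * sum (arc G i))           ≡⟨ sum-cong-≗ (λ i → cong (χ X i *_) (Σ≡∑ n (arc G i))) ⟨
  volume G X                                  ∎
  where
  open ≡-Reasoning
  term : (Fin n → Bool) → Fin n → Fin n → ℕ
  term Z i j = χ X i * χ Z j * arc G i j
  regroup : ∀ x y y′ a → x * y * a + x * y′ * a ≡ x * (y + y′) * a
  regroup = solve-∀
  split : ∀ i j → term Y i j + term (∁ Y) i j ≡ χ X i * arc G i j
  split i j = begin
    term Y i j + term (∁ Y) i j              ≡⟨ regroup (χ X i) (χ Y j) (χ (∁ Y) j) (arc G i j) ⟩
    χ X i * (χ Y j + χ (∁ Y) j) * arc G i j  ≡⟨ cong (λ y → χ X i * y * arc G i j) (χ+χ∁≡1 Y j) ⟩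
    χ X i * 1 * arc G i j                    ≡⟨ cong (_* arc G i j) (*-identityʳ (χ X i)) ⟩
    χ X i * arc G i j                        ∎

allArcs-split : ∀ {n} (G : Graph n) X →
                allArcs G ≡ arcs G X X + arcs G (∁ X) (∁ X) + 2 * arcs G X (∁ X)
allArcs-split {n} G X = begin
  allArcs G
    ≡⟨ sum²-cong split ⟩
  sum² (λ i j → term X X i j + term (∁ X) (∁ X) i j + (term X (∁ X) i j + term (∁ X) X i j))
    ≡⟨ sum²-distrib-+ (λ i j → term X X i j + term (∁ X) (∁ X) i j) (λ i j → term X (∁ X) i j + term (∁ X) X i j) ⟩
  sum² (λ i j → term X X i j + term (∁ X) (∁ X) i j) + sum² (λ i j → term X (∁ X) i j + term (∁ X) X i j)
    ≡⟨ cong₂ _+_ (sum²-distrib-+ (term X X) (term (∁ X) (∁ X))) (sum²-distrib-+ (term X (∁ X)) (term (∁ X) X)) ⟩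
  arcs G X X + arcs G (∁ X) (∁ X) + (arcs G X (∁ X) + arcs G (∁ X) X)
    ≡⟨ cong (λ c → arcs G X X + arcs G (∁ X) (∁ X) + (arcs G X (∁ X) + c)) (arcs-sym G (∁ X) X) ⟩
  arcs G X X + arcs G (∁ X) (∁ X) + (arcs G X (∁ X) + arcs G X (∁ X))
    ≡⟨ cong (arcs G X X + arcs G (∁ X) (∁ X) +_) (m+m≡2*m (arcs G X (∁ X))) ⟩
  arcs G X X + arcs G (∁ X) (∁ X) + 2 * arcs G X (∁ X)
    ∎
  where
  open ≡-Reasoning
  term : (Fin n → Bool) → (Fin n → Bool) → Fin n → Fin n → ℕ
  term Y Z i j = χ Y i * χ Z j * arc G i j
  expand : ∀ x x′ y y′ a → (x + x′) * (y + y′) * a ≡ x * y * a + x′ * y′ * a + (x * y′ * a + x′ * y * a)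
  expand = solve-∀
  split : ∀ i j → arc G i j ≡ term X X i j + term (∁ X) (∁ X) i j + (term X (∁ X) i j + term (∁ X) X i j)
  split i j = begin
    arc G i j                                              ≡⟨ *-identityˡ (arc G i j) ⟨
    1 * arc G i j                                          ≡⟨ cong₂ (λ x y → x * y * arc G i j) (χ+χ∁≡1 X i) (χ+χ∁≡1 X j) ⟨
    (χ X i + χ (∁ X) i) * (χ X j + χ (∁ X) j) * arc G i j  ≡⟨ expand (χ X i) (χ (∁ X) i) (χ X j) (χ (∁ X) j) (arc G i j) ⟩
    term X X i j + term (∁ X) (∁ X) i j + (term X (∁ X) i j + term (∁ X) X i j) ∎

arc+δ≤1 : ∀ {n} (G : Graph n) i j → arc G i j + δ i j ≤ 1
arc+δ≤1 G i j = exclusive (adj G i j) (eqᵇ i j) (eqᵇ⇒¬adj G)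
  where
  exclusive : ∀ a d → (d ≡ true → a ≡ false) → indicator a + indicator d ≤ 1
  exclusive true  false _    = ≤-refl
  exclusive false false _    = z≤n
  exclusive a     true  d⇒¬a rewrite d⇒¬a refl = ≤-refl

arcs+size≤size² : ∀ {n} (G : Graph n) X → arcs G X X + size X ≤ size X * size X
arcs+size≤size² {n} G X = begin
  arcs G X X + size X
    ≡⟨ cong (arcs G X X +_) diagonal ⟩
  arcs G X X + sum² (λ i j → δ i j * (χ X i * χ X j))
    ≡⟨ sum²-distrib-+ (λ i j → χ X i * χ X j * arc G i j) (λ i j → δ i j * (χ X i * χ X j)) ⟨
  sum² (λ i j → χ X i * χ X j * arc G i j + δ i j * (χ X i * χ X j))
    ≤⟨ sum²-mono-≤ pointwise ⟩
  sum² (λ i j → χ X i * χ X j)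
    ≡⟨ ∑-*-∑ (χ X) (χ X) ⟨
  size X * size X
    ∎
  where
  open ≤-Reasoning
  diagonal : size X ≡ sum² (λ i j → δ i j * (χ X i * χ X j))
  diagonal = sum-cong-≗ λ i → trans (sym (χ*χ≡χ X i)) (sym (∑-δ i (λ j → χ X i * χ X j)))
  factor : ∀ u a d → u * a + d * u ≡ u * (a + d)
  factor = solve-∀
  pointwise : ∀ i j → χ X i * χ X j * arc G i j + δ i j * (χ X i * χ X j) ≤ χ X i * χ X j
  pointwise i j = begin
    u * arc G i j + δ i j * u  ≡⟨ factor u (arc G i j) (δ i j) ⟩
    u * (arc G i j + δ i j)    ≤⟨ *-monoʳ-≤ u (arc+δ≤1 G i j) ⟩
    u * 1                      ≡⟨ *-identityʳ u ⟩
    u                          ∎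
    where
    u : ℕ
    u = χ X i * χ X j

2*arcs-cut≤allArcs : ∀ {n} (H : Graph n) X → 2 * arcs H X (∁ X) ≤ allArcs H
2*arcs-cut≤allArcs {n} H X = begin
  2 * arcs H X (∁ X)                                   ≡⟨ m+m≡2*m (arcs H X (∁ X)) ⟨
  arcs H X (∁ X) + arcs H X (∁ X)                      ≡⟨ cong (arcs H X (∁ X) +_) (arcs-sym H X (∁ X)) ⟩
  arcs H X (∁ X) + arcs H (∁ X) X                      ≡⟨ sum²-distrib-+ (term X (∁ X)) (term (∁ X) X) ⟨
  sum² (λ i j → term X (∁ X) i j + term (∁ X) X i j)   ≤⟨ sum²-mono-≤ pointwise ⟩
  allArcs H                                            ∎
  where
  open ≤-Reasoning
  term : (Fin n → Bool) → (Fin n → Bool) → Fin n → Fin n → ℕ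
  term Y Z i j = χ Y i * χ Z j * arc H i j
  crossing : ∀ x y → indicator x * indicator (not y) + indicator (not x) * indicator y ≤ 1
  crossing true  true  = z≤n
  crossing true  false = ≤-refl
  crossing false true  = ≤-refl
  crossing false false = z≤n
  pointwise : ∀ i j → term X (∁ X) i j + term (∁ X) X i j ≤ arc H i j
  pointwise i j = begin
    term X (∁ X) i j + term (∁ X) X i j                  ≡⟨ *-distribʳ-+ (arc H i j) (χ X i * χ (∁ X) j) (χ (∁ X) i * χ X j) ⟨
    (χ X i * χ (∁ X) j + χ (∁ X) i * χ X j) * arc H i j  ≤⟨ *-monoˡ-≤ (arc H i j) (crossing (X i) (X j)) ⟩
    1 * arc H i j                                        ≡⟨ *-identityˡ (arc H i j) ⟩
    arc H i j                                            ∎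

-- The complement graph

complement : ∀ {n} → Graph n → Graph n
complement G = record
  { adj    = λ i j → not (eqᵇ i j ∨ adj G i j)
  ; sym    = λ i j → cong₂ (λ e a → not (e ∨ a)) (≡ᵇ-sym (toℕ i) (toℕ j)) (Graph.sym G i j)
  ; irrefl = λ i → cong (λ e → not (e ∨ adj G i i)) (≡ᵇ-refl (toℕ i))
  }

arcs+arcs-complement≡size*size : ∀ {n} (G : Graph n) X →
                                 arcs G X (∁ X) + arcs (complement G) X (∁ X) ≡ size X * size (∁ X)
arcs+arcs-complement≡size*size {n} G X = begin
  arcs G X (∁ X) + arcs (complement G) X (∁ X)          ≡⟨ sum²-distrib-+ (term G) (term (complement G)) ⟨
  sum² (λ i j → term G i j + term (complement G) i j)
    ≡⟨ sum²-cong (λ i j → pointwise (eqᵇ i j) (X i) (X j) (adj G i j) (λ e → cong X (eqᵇ⇒≡ {i = i} e))) ⟩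
  sum² (λ i j → χ X i * χ (∁ X) j)                      ≡⟨ ∑-*-∑ (χ X) (χ (∁ X)) ⟨
  size X * size (∁ X)                                   ∎
  where
  open ≡-Reasoning
  term : Graph n → Fin n → Fin n → ℕ
  term H i j = χ X i * χ (∁ X) j * arc H i j
  pointwise : ∀ d x y a → (d ≡ true → x ≡ y) →
              indicator x * indicator (not y) * indicator a + indicator x * indicator (not y) * indicator (not (d ∨ a))
              ≡ indicator x * indicator (not y)
  pointwise false x y a _ = begin
    u * indicator a + u * indicator (not a)  ≡⟨ *-distribˡ-+ u (indicator a) (indicator (not a)) ⟨
    u * (indicator a + indicator (not a))    ≡⟨ cong (u *_) (indicator+indicator-not a) ⟩
    u * 1                                    ≡⟨ *-identityʳ u ⟩
    u                                        ∎
    where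
    u : ℕ
    u = indicator x * indicator (not y)
  pointwise true x y a d⇒x≡y with d⇒x≡y refl
  pointwise true false _ a _ | refl = refl
  pointwise true true  _ a _ | refl = refl

allArcs+allArcs-complement : ∀ {n} (G : Graph n) → allArcs G + allArcs (complement G) + n ≡ n * n
allArcs+allArcs-complement {n} G = begin
  allArcs G + allArcs (complement G) + n
    ≡⟨ cong (allArcs G + allArcs (complement G) +_) diagonal ⟩
  allArcs G + allArcs (complement G) + sum² (δ {n})
    ≡⟨ cong (_+ sum² (δ {n})) (sum²-distrib-+ (arc G) (arc (complement G))) ⟨
  sum² (λ i j → arc G i j + arc (complement G) i j) + sum² (δ {n})
    ≡⟨ sum²-distrib-+ (λ i j → arc G i j + arc (complement G) i j) (δ {n}) ⟨
  sum² (λ i j → arc G i j + arc (complement G) i j + δ i j)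
    ≡⟨ sum²-cong (λ i j → exactlyOne (adj G i j) (eqᵇ i j) (eqᵇ⇒¬adj G)) ⟩
  sum {n} (λ _ → sum {n} (λ _ → 1))
    ≡⟨ sum-cong-≗ {n} (λ _ → trans (∑-const n 1) (*-identityʳ n)) ⟩
  sum {n} (λ _ → n)
    ≡⟨ ∑-const n n ⟩
  n * n
    ∎
  where
  open ≡-Reasoning
  diagonal : n ≡ sum² (δ {n})
  diagonal = begin
    n                              ≡⟨ *-identityʳ n ⟨
    n * 1                          ≡⟨ ∑-const n 1 ⟨
    sum {n} (λ _ → 1)              ≡⟨ sum-cong-≗ {n} (λ i → ∑-δ i (λ _ → 1)) ⟨
    sum² (λ i j → δ {n} i j * 1)   ≡⟨ sum²-cong {n} (λ i j → *-identityʳ (δ i j)) ⟩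
    sum² (δ {n})                   ∎
  exactlyOne : ∀ a d → (d ≡ true → a ≡ false) → indicator a + indicator (not (d ∨ a)) + indicator d ≡ 1
  exactlyOne true  false _    = refl
  exactlyOne false false _    = refl
  exactlyOne a     true  d⇒¬a rewrite d⇒¬a refl = refl

edges+edges-complement≡nC2 : ∀ {n} (G : Graph n) → edges G + edges (complement G) ≡ n C 2
edges+edges-complement≡nC2 {n} G = *-cancelˡ-≡ _ _ 2 (+-cancelʳ-≡ n _ _ (begin
  2 * (edges G + edges (complement G)) + n    ≡⟨ cong (_+ n) (*-distribˡ-+ 2 (edges G) (edges (complement G))) ⟩
  2 * edges G + 2 * edges (complement G) + n  ≡⟨ cong₂ (λ a b → a + b + n) (2*edges≡allArcs G) (2*edges≡allArcs (complement G)) ⟩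
  allArcs G + allArcs (complement G) + n      ≡⟨ allArcs+allArcs-complement G ⟩
  n * n                                       ≡⟨ 2*nC2+n≡n*n n ⟨
  2 * (n C 2) + n                             ∎))
  where open ≡-Reasoning

-- Blocks of a partition

block : ∀ {n} → Partition n → Fin n → Fin n → Bool
block f k i = eqᵇ (f i) k

2*blockEdges≡arcs : ∀ {n} (G : Graph n) (f : Partition n) k → 2 * blockEdges G f k ≡ arcs G (block f k) (block f k)
2*blockEdges≡arcs {n} G f k = begin
  2 * blockEdges G f k                                    ≡⟨ cong (2 *_) (Σ²≡sum² n _) ⟩
  2 * sum² (λ i j → δ< i j * arc G i j * χ B i * χ B j)   ≡⟨ cong (2 *_) (sum²-cong (λ i j → regroup (δ< i j) (arc G i j) (χ B i) (χ B j))) ⟩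
  2 * sum² (λ i j → δ< i j * g i j)                       ≡⟨ sum²≡2*sum²< g g-sym g-hollow ⟨
  arcs G B B                                              ∎
  where
  open ≡-Reasoning
  B : Fin n → Bool
  B = block f k
  g : Fin n → Fin n → ℕ
  g i j = χ B i * χ B j * arc G i j
  g-sym : ∀ i j → g i j ≡ g j i
  g-sym i j = cong₂ _*_ (*-comm (χ B i) (χ B j)) (arc-sym G i j)
  g-hollow : ∀ i → g i i ≡ 0
  g-hollow i = trans (cong (χ B i * χ B i *_) (arc-irrefl G i)) (*-zeroʳ (χ B i * χ B i))
  regroup : ∀ l a x y → l * a * x * y ≡ l * (x * y * a)
  regroup = solve-∀

∑-cuts≤allArcs : ∀ {n} (H : Graph n) (f : Partition n) →
                 sum (λ k → arcs H (block f k) (∁ (block f k))) ≤ allArcs H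
∑-cuts≤allArcs {n} H f = begin
  sum (λ k → sum² (term k))                ≡⟨ ∑-comm (λ k i → sum (term k i)) ⟩
  sum (λ i → sum (λ k → sum (term k i)))   ≡⟨ sum-cong-≗ (λ i → ∑-comm (λ k → term k i)) ⟩
  sum² (λ i j → sum (λ k → term k i j))    ≤⟨ sum²-mono-≤ pointwise ⟩
  allArcs H                                ∎
  where
  open ≤-Reasoning
  term : Fin n → Fin n → Fin n → ℕ
  term k i j = χ (block f k) i * χ (∁ (block f k)) j * arc H i j
  pointwise : ∀ i j → sum (λ k → term k i j) ≤ arc H i j
  pointwise i j = begin
    sum (λ k → term k i j)
      ≤⟨ ∑-mono-≤ (λ k → *-monoˡ-≤ (arc H i j) (m*n≤m (δ (f i) k) (χ≤1 (∁ (block f k)) j))) ⟩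
    sum (λ k → δ (f i) k * arc H i j)
      ≡⟨ ∑-δ (f i) (λ _ → arc H i j) ⟩
    arc H i j
      ∎

block-inequality : ∀ {n} (G : Graph n) X →
                   allArcs G * arcs G X X ≤ volume G X * volume G X + allArcs G * (2 * arcs (complement G) X (∁ X) ∸ n)
block-inequality {n} G X =
  subst₂ (λ M v → M * p ≤ v * v + M * (2 * d ∸ n)) (sym (allArcs-split G X)) (arcs+arcs∁≡volume G X X)
    (subst (λ s → (p + q + 2 * c) * p ≤ (p + c) * (p + c) + (p + q + 2 * c) * (2 * d ∸ s)) (size+size∁≡n X)
      (cut-inequality {size X} {size (∁ X)} {p} {q} {c} {d}
        (arcs+size≤size² G X) (arcs+size≤size² G (∁ X)) (arcs+arcs-complement≡size*size G X)))
  where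
  p q c d : ℕ
  p = arcs G X X
  q = arcs G (∁ X) (∁ X)
  c = arcs G X (∁ X)
  d = arcs (complement G) X (∁ X)

∑-block-inequality : ∀ {n} (G : Graph n) (f : Partition n) →
  allArcs G * sum (λ k → arcs G (block f k) (block f k))
    ≤ sum (λ k → volume G (block f k) * volume G (block f k)) + allArcs G * (2 * (allArcs (complement G) ∸ n))
∑-block-inequality {n} G f = begin
  M * sum (λ k → arcs G (B k) (B k))     ≡⟨ *-distribˡ-sum M (λ k → arcs G (B k) (B k)) ⟩
  sum (λ k → M * arcs G (B k) (B k))     ≤⟨ ∑-mono-≤ (λ k → block-inequality G (B k)) ⟩
  sum (λ k → vol² k + M * (x k ∸ n))     ≡⟨ ∑-distrib-+ vol² (λ k → M * (x k ∸ n)) ⟩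
  sum vol² + sum (λ k → M * (x k ∸ n))   ≡⟨ cong (sum vol² +_) (*-distribˡ-sum M (λ k → x k ∸ n)) ⟨
  sum vol² + M * sum (λ k → x k ∸ n)     ≤⟨ +-monoʳ-≤ (sum vol²) (*-monoʳ-≤ M ∑[x∸n]≤2[T∸n]) ⟩
  sum vol² + M * (2 * (allArcs Ḡ ∸ n))   ∎
  where
  open ≤-Reasoning
  M : ℕ
  M = allArcs G
  Ḡ : Graph n
  Ḡ = complement G
  B : Fin n → Fin n → Bool
  B = block f
  vol² x : Fin n → ℕ
  vol² k = volume G (B k) * volume G (B k)
  x k = 2 * arcs Ḡ (B k) (∁ (B k))
  ∑x≤2T : sum x ≤ 2 * allArcs Ḡ
  ∑x≤2T = begin
    sum x                                     ≡⟨ *-distribˡ-sum 2 (λ k → arcs Ḡ (B k) (∁ (B k))) ⟨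
    2 * sum (λ k → arcs Ḡ (B k) (∁ (B k)))    ≤⟨ *-monoʳ-≤ 2 (∑-cuts≤allArcs Ḡ f) ⟩
    2 * allArcs Ḡ                             ∎
  ∑[x∸n]≤2[T∸n] : sum (λ k → x k ∸ n) ≤ 2 * (allArcs Ḡ ∸ n)
  ∑[x∸n]≤2[T∸n] = ∑-∸-bound x {allArcs Ḡ} {2} n (λ k → 2*arcs-cut≤allArcs Ḡ (B k)) ∑x≤2T

partition-inequality : ∀ {n} (G : Graph n) (f : Partition n) →
  4 * edges G * Σ[ n ] (blockEdges G f)
    ≤ Σ[ n ] (λ k → vol G f k * vol G f k) + 4 * edges G * (2 * edges (complement G) ∸ n)
partition-inequality {n} G f = begin
  4 * m * Σ[ n ] (blockEdges G f)                            ≡⟨ regroup m (Σ[ n ] (blockEdges G f)) ⟩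
  2 * m * (2 * Σ[ n ] (blockEdges G f))                      ≡⟨ cong₂ _*_ (2*edges≡allArcs G) 2E≡∑arcs ⟩
  allArcs G * sum (λ k → arcs G (B k) (B k))                 ≤⟨ ∑-block-inequality G f ⟩
  ∑volume² + allArcs G * (2 * (allArcs Ḡ ∸ n))
    ≡⟨ cong (∑volume² +_) (cong₂ (λ M T → M * (2 * (T ∸ n))) (2*edges≡allArcs G) (2*edges≡allArcs Ḡ)) ⟨
  ∑volume² + 2 * m * (2 * (2 * edges Ḡ ∸ n))                ≡⟨ cong₂ _+_ ∑volume²≡Σvol² (regroup′ m (2 * edges Ḡ ∸ n)) ⟩
  Σ[ n ] (λ k → vol G f k * vol G f k) + 4 * m * (2 * edges Ḡ ∸ n)
    ∎
  where
  open ≤-Reasoning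
  m : ℕ
  m = edges G
  Ḡ : Graph n
  Ḡ = complement G
  B : Fin n → Fin n → Bool
  B = block f
  ∑volume² : ℕ
  ∑volume² = sum (λ k → volume G (B k) * volume G (B k))
  regroup : ∀ m E → 4 * m * E ≡ 2 * m * (2 * E)
  regroup = solve-∀
  regroup′ : ∀ m t → 2 * m * (2 * t) ≡ 4 * m * t
  regroup′ = solve-∀
  2E≡∑arcs : 2 * Σ[ n ] (blockEdges G f) ≡ sum (λ k → arcs G (B k) (B k))
  2E≡∑arcs = begin-equality
    2 * Σ[ n ] (blockEdges G f)        ≡⟨ cong (2 *_) (Σ≡∑ n (blockEdges G f)) ⟩
    2 * sum (blockEdges G f)           ≡⟨ *-distribˡ-sum 2 (blockEdges G f) ⟩
    sum (λ k → 2 * blockEdges G f k)   ≡⟨ sum-cong-≗ (2*blockEdges≡arcs G f) ⟩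
    sum (λ k → arcs G (B k) (B k))     ∎
  ∑volume²≡Σvol² : ∑volume² ≡ Σ[ n ] (λ k → vol G f k * vol G f k)
  ∑volume²≡Σvol² = begin-equality
    ∑volume²                               ≡⟨ sum-cong-≗ {n} (λ k → cong (λ v → v * v) (Σ≡∑ n _)) ⟨
    sum (λ k → vol G f k * vol G f k)      ≡⟨ Σ≡∑ n (λ k → vol G f k * vol G f k) ⟨
    Σ[ n ] (λ k → vol G f k * vol G f k)   ∎

-- Passing to ℚ

-- ℕ→ℚ k is produced by normalisation; its arithmetic is read off in ℚᵘ, where k/1 is a literal.

ℕ→ℚᵘ : ℕ → ℚᵘ.ℚᵘ
ℕ→ℚᵘ k = ℚᵘ.mkℚᵘ (ℤ.+ k) 0

ℕ→ℚᵘ-+ : ∀ a b → ℕ→ℚᵘ (a + b) ℚᵘ.≃ ℕ→ℚᵘ a ℚᵘ.+ ℕ→ℚᵘ b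
ℕ→ℚᵘ-+ a b = ℚᵘ.*≡* (begin
  ℤ.+ (a + b) ℤ.* ℤ.1ℤ                         ≡⟨ ℤP.*-identityʳ (ℤ.+ (a + b)) ⟩
  ℤ.+ (a + b)                                  ≡⟨ ℤP.pos-+ a b ⟩
  ℤ.+ a ℤ.+ ℤ.+ b                              ≡⟨ cong₂ ℤ._+_ (ℤP.*-identityʳ (ℤ.+ a)) (ℤP.*-identityʳ (ℤ.+ b)) ⟨
  ℤ.+ a ℤ.* ℤ.1ℤ ℤ.+ ℤ.+ b ℤ.* ℤ.1ℤ            ≡⟨ ℤP.*-identityʳ (ℤ.+ a ℤ.* ℤ.1ℤ ℤ.+ ℤ.+ b ℤ.* ℤ.1ℤ) ⟨
  (ℤ.+ a ℤ.* ℤ.1ℤ ℤ.+ ℤ.+ b ℤ.* ℤ.1ℤ) ℤ.* ℤ.1ℤ ∎)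
  where open ≡-Reasoning

ℕ→ℚᵘ-* : ∀ a b → ℕ→ℚᵘ (a * b) ℚᵘ.≃ ℕ→ℚᵘ a ℚᵘ.* ℕ→ℚᵘ b
ℕ→ℚᵘ-* a b = ℚᵘ.*≡* (trans (ℤP.*-identityʳ (ℤ.+ (a * b))) (trans (ℤP.pos-* a b) (sym (ℤP.*-identityʳ _))))

ℕ→ℚᵘ-mono-≤ : ∀ {a b} → a ≤ b → ℕ→ℚᵘ a ℚᵘ.≤ ℕ→ℚᵘ b
ℕ→ℚᵘ-mono-≤ {a} {b} a≤b = ℚᵘ.*≤* (subst₂ ℤ._≤_ (sym (ℤP.*-identityʳ (ℤ.+ a))) (sym (ℤP.*-identityʳ (ℤ.+ b))) (ℤ.+≤+ a≤b))

toℚᵘ-ℕ→ℚ : ∀ k → ℚ.toℚᵘ (ℕ→ℚ k) ℚᵘ.≃ ℕ→ℚᵘ k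
toℚᵘ-ℕ→ℚ k = ℚP.toℚᵘ-fromℚᵘ (ℕ→ℚᵘ k)

ℕ→ℚ-+ : ∀ a b → ℕ→ℚ (a + b) ≡ ℕ→ℚ a ℚ.+ ℕ→ℚ b
ℕ→ℚ-+ a b = ℚP.toℚᵘ-injective (begin
  ℚ.toℚᵘ (ℕ→ℚ (a + b))                     ≈⟨ toℚᵘ-ℕ→ℚ (a + b) ⟩
  ℕ→ℚᵘ (a + b)                             ≈⟨ ℕ→ℚᵘ-+ a b ⟩
  ℕ→ℚᵘ a ℚᵘ.+ ℕ→ℚᵘ b                       ≈⟨ ℚᵘP.+-cong (toℚᵘ-ℕ→ℚ a) (toℚᵘ-ℕ→ℚ b) ⟨
  ℚ.toℚᵘ (ℕ→ℚ a) ℚᵘ.+ ℚ.toℚᵘ (ℕ→ℚ b)       ≈⟨ ℚP.toℚᵘ-homo-+ (ℕ→ℚ a) (ℕ→ℚ b) ⟨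
  ℚ.toℚᵘ (ℕ→ℚ a ℚ.+ ℕ→ℚ b)                 ∎)
  where open ℚᵘP.≃-Reasoning

ℕ→ℚ-* : ∀ a b → ℕ→ℚ (a * b) ≡ ℕ→ℚ a ℚ.* ℕ→ℚ b
ℕ→ℚ-* a b = ℚP.toℚᵘ-injective (begin
  ℚ.toℚᵘ (ℕ→ℚ (a * b))                     ≈⟨ toℚᵘ-ℕ→ℚ (a * b) ⟩
  ℕ→ℚᵘ (a * b)                             ≈⟨ ℕ→ℚᵘ-* a b ⟩
  ℕ→ℚᵘ a ℚᵘ.* ℕ→ℚᵘ b                       ≈⟨ ℚᵘP.*-cong (toℚᵘ-ℕ→ℚ a) (toℚᵘ-ℕ→ℚ b) ⟨
  ℚ.toℚᵘ (ℕ→ℚ a) ℚᵘ.* ℚ.toℚᵘ (ℕ→ℚ b)       ≈⟨ ℚP.toℚᵘ-homo-* (ℕ→ℚ a) (ℕ→ℚ b) ⟨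
  ℚ.toℚᵘ (ℕ→ℚ a ℚ.* ℕ→ℚ b)                 ∎)
  where open ℚᵘP.≃-Reasoning

ℕ→ℚ-mono-≤ : ∀ {a b} → a ≤ b → ℕ→ℚ a ℚ.≤ ℕ→ℚ b
ℕ→ℚ-mono-≤ {a} {b} a≤b =
  ℚP.toℚᵘ-cancel-≤ (ℚᵘP.≤-respˡ-≃ (ℚᵘP.≃-sym (toℚᵘ-ℕ→ℚ a)) (ℚᵘP.≤-respʳ-≃ (ℚᵘP.≃-sym (toℚᵘ-ℕ→ℚ b)) (ℕ→ℚᵘ-mono-≤ a≤b)))

[a/d]*d≡a : ∀ a d .{{_ : NonZero d}} → (ℤ.+ a ℚ./ d) ℚ.* ℕ→ℚ d ≡ ℕ→ℚ a
[a/d]*d≡a a d@(suc d-1) = ℚP.toℚᵘ-injective (begin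
  ℚ.toℚᵘ ((ℤ.+ a ℚ./ d) ℚ.* ℕ→ℚ d)             ≈⟨ ℚP.toℚᵘ-homo-* (ℤ.+ a ℚ./ d) (ℕ→ℚ d) ⟩
  ℚ.toℚᵘ (ℤ.+ a ℚ./ d) ℚᵘ.* ℚ.toℚᵘ (ℕ→ℚ d)      ≈⟨ ℚᵘP.*-cong (ℚP.toℚᵘ-fromℚᵘ (ℚᵘ.mkℚᵘ (ℤ.+ a) d-1)) (toℚᵘ-ℕ→ℚ d) ⟩
  ℚᵘ.mkℚᵘ (ℤ.+ a) d-1 ℚᵘ.* ℕ→ℚᵘ d              ≈⟨ ℚᵘ.*≡* cancel ⟩
  ℕ→ℚᵘ a                                       ≈⟨ toℚᵘ-ℕ→ℚ a ⟨
  ℚ.toℚᵘ (ℕ→ℚ a)                               ∎)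
  where
  open ℚᵘP.≃-Reasoning
  cancel : (ℤ.+ a ℤ.* ℤ.+ d) ℤ.* ℤ.1ℤ ≡ ℤ.+ a ℤ.* ℤ.+ (d * 1)
  cancel = trans (ℤP.*-identityʳ _) (cong (λ e → ℤ.+ a ℤ.* ℤ.+ e) (sym (*-identityʳ d)))

inv-nonNeg : ∀ k → ℚ.NonNegative (inv k)
inv-nonNeg zero    = _
inv-nonNeg (suc k) = ℚP.normalize-nonNeg 1 (suc k)

inv*k≡1 : ∀ k .{{_ : NonZero k}} → inv k ℚ.* ℕ→ℚ k ≡ ℚ.1ℚ
inv*k≡1 (suc k) = [a/d]*d≡a 1 (suc k)

quotient-bound : ∀ {m E V t} .{{_ : NonZero m}} → 4 * m * E ≤ V + 4 * m * t →
                 inv m ℚ.* ℕ→ℚ E ℚ.- inv (4 * m * m) ℚ.* ℕ→ℚ V ℚ.≤ ℕ→ℚ t ℚ.* inv m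
quotient-bound {m} {E} {V} {t} 4mE≤V+4mt = begin
  1/m ℚ.* Ê ℚ.- 1/4m² ℚ.* V̂
    ≡⟨ cong (λ x → x ℚ.* Ê ℚ.- 1/4m² ℚ.* V̂) 4m/4m²≡1/m ⟨
  1/4m² ℚ.* 4m̂ ℚ.* Ê ℚ.- 1/4m² ℚ.* V̂
    ≡⟨ cong (ℚ._- 1/4m² ℚ.* V̂) (ℚP.*-assoc 1/4m² 4m̂ Ê) ⟩
  1/4m² ℚ.* (4m̂ ℚ.* Ê) ℚ.- 1/4m² ℚ.* V̂
    ≤⟨ ℚP.+-monoˡ-≤ (ℚ.- (1/4m² ℚ.* V̂)) (ℚP.*-monoˡ-≤-nonNeg 1/4m² {{inv-nonNeg (4 * m * m)}} lifted) ⟩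
  1/4m² ℚ.* (V̂ ℚ.+ 4m̂ ℚ.* t̂) ℚ.- 1/4m² ℚ.* V̂
    ≡⟨ solve 4 (λ j v f t → j :* (v :+ f :* t) :- j :* v := j :* f :* t) refl 1/4m² V̂ 4m̂ t̂ ⟩
  1/4m² ℚ.* 4m̂ ℚ.* t̂
    ≡⟨ cong (ℚ._* t̂) 4m/4m²≡1/m ⟩
  1/m ℚ.* t̂
    ≡⟨ ℚP.*-comm 1/m t̂ ⟩
  t̂ ℚ.* 1/m
    ∎
  where
  open ℚP.≤-Reasoning
  open +-*-Solver
  1/m 1/4m² 4m̂ Ê V̂ t̂ m̂ : ℚ.ℚ
  1/m = inv m
  1/4m² = inv (4 * m * m)
  4m̂ = ℕ→ℚ (4 * m)
  Ê = ℕ→ℚ E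
  V̂ = ℕ→ℚ V
  t̂ = ℕ→ℚ t
  m̂ = ℕ→ℚ m
  4m/4m²≡1/m : 1/4m² ℚ.* 4m̂ ≡ 1/m
  4m/4m²≡1/m = begin-equality
    1/4m² ℚ.* 4m̂                        ≡⟨ ℚP.*-identityʳ (1/4m² ℚ.* 4m̂) ⟨
    1/4m² ℚ.* 4m̂ ℚ.* ℚ.1ℚ               ≡⟨ cong (1/4m² ℚ.* 4m̂ ℚ.*_) (inv*k≡1 m) ⟨
    1/4m² ℚ.* 4m̂ ℚ.* (1/m ℚ.* m̂)        ≡⟨ solve 4 (λ j f i m → j :* f :* (i :* m) := j :* (f :* m) :* i) refl 1/4m² 4m̂ 1/m m̂ ⟩
    1/4m² ℚ.* (4m̂ ℚ.* m̂) ℚ.* 1/m        ≡⟨ cong (λ x → 1/4m² ℚ.* x ℚ.* 1/m) (ℕ→ℚ-* (4 * m) m) ⟨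
    1/4m² ℚ.* ℕ→ℚ (4 * m * m) ℚ.* 1/m   ≡⟨ cong (ℚ._* 1/m) (inv*k≡1 (4 * m * m) {{m*n≢0 (4 * m) m {{m*n≢0 4 m}}}}) ⟩
    ℚ.1ℚ ℚ.* 1/m                        ≡⟨ ℚP.*-identityˡ 1/m ⟩
    1/m                                 ∎
  lifted : 4m̂ ℚ.* Ê ℚ.≤ V̂ ℚ.+ 4m̂ ℚ.* t̂
  lifted = subst₂ ℚ._≤_ (ℕ→ℚ-* (4 * m) E) (trans (ℕ→ℚ-+ V (4 * m * t)) (cong (V̂ ℚ.+_) (ℕ→ℚ-* (4 * m) t)))
                 (ℕ→ℚ-mono-≤ 4mE≤V+4mt)

2e∸n≤2[e-n/2]⁺ : ∀ e n → ℕ→ℚ (2 * e ∸ n) ℚ.≤ ℕ→ℚ 2 ℚ.* ((ℕ→ℚ e ℚ.- ℤ.+ n ℚ./ 2) ⁺)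
2e∸n≤2[e-n/2]⁺ e n = [ excess , deficit ]′ (≤-total n (2 * e))
  where
  open ℚP.≤-Reasoning
  open +-*-Solver
  x ê n/2 2̂ : ℚ.ℚ
  x = ℕ→ℚ e ℚ.- ℤ.+ n ℚ./ 2
  ê = ℕ→ℚ e
  n/2 = ℤ.+ n ℚ./ 2
  2̂ = ℕ→ℚ 2
  excess : n ≤ 2 * e → ℕ→ℚ (2 * e ∸ n) ℚ.≤ 2̂ ℚ.* (x ⁺)
  excess n≤2e = begin
    ℕ→ℚ (2 * e ∸ n)                               ≡⟨ solve 2 (λ d n → d := d :+ n :- n) refl (ℕ→ℚ (2 * e ∸ n)) (ℕ→ℚ n) ⟩
    ℕ→ℚ (2 * e ∸ n) ℚ.+ ℕ→ℚ n ℚ.- ℕ→ℚ n           ≡⟨ cong (ℚ._- ℕ→ℚ n) (ℕ→ℚ-+ (2 * e ∸ n) n) ⟨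
    ℕ→ℚ (2 * e ∸ n + n) ℚ.- ℕ→ℚ n                 ≡⟨ cong₂ (λ a b → ℕ→ℚ a ℚ.- b) (m∸n+n≡m n≤2e) (sym ([a/d]*d≡a n 2)) ⟩
    ℕ→ℚ (2 * e) ℚ.- n/2 ℚ.* 2̂                     ≡⟨ cong (ℚ._- n/2 ℚ.* 2̂) (ℕ→ℚ-* 2 e) ⟩
    2̂ ℚ.* ê ℚ.- n/2 ℚ.* 2̂                         ≡⟨ solve 3 (λ t e h → t :* e :- h :* t := t :* (e :- h)) refl 2̂ ê n/2 ⟩
    2̂ ℚ.* x                                       ≤⟨ ℚP.*-monoˡ-≤-nonNeg 2̂ {{ℚP.normalize-nonNeg 2 1}} (ℚP.p≤p⊔q x ℚ.0ℚ) ⟩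
    2̂ ℚ.* (x ⁺)                                   ∎
  deficit : 2 * e ≤ n → ℕ→ℚ (2 * e ∸ n) ℚ.≤ 2̂ ℚ.* (x ⁺)
  deficit 2e≤n = begin
    ℕ→ℚ (2 * e ∸ n)                               ≡⟨ cong ℕ→ℚ (m≤n⇒m∸n≡0 2e≤n) ⟩
    ℚ.0ℚ                                          ≡⟨ ℚP.*-zeroʳ 2̂ ⟨
    2̂ ℚ.* ℚ.0ℚ                                    ≤⟨ ℚP.*-monoˡ-≤-nonNeg 2̂ {{ℚP.normalize-nonNeg 2 1}} (ℚP.p≤q⊔p x ℚ.0ℚ) ⟩
    2̂ ℚ.* (x ⁺)                                   ∎

bound≡2[ē-n/2]⁺/m : ∀ {n} (G : Graph n) →
                    bound G ≡ ℕ→ℚ 2 ℚ.* ((ℕ→ℚ (edges (complement G)) ℚ.- ℤ.+ n ℚ./ 2) ⁺) ℚ.* inv (edges G)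
bound≡2[ē-n/2]⁺/m {n} G = cong (λ x → ℕ→ℚ 2 ℚ.* (x ⁺) ℚ.* inv m) (begin
  ℕ→ℚ (n C 2) ℚ.- n/2 ℚ.- m̂      ≡⟨ cong (λ c → ℕ→ℚ c ℚ.- n/2 ℚ.- m̂) (edges+edges-complement≡nC2 G) ⟨
  ℕ→ℚ (m + ē) ℚ.- n/2 ℚ.- m̂      ≡⟨ cong (λ c → c ℚ.- n/2 ℚ.- m̂) (ℕ→ℚ-+ m ē) ⟩
  m̂ ℚ.+ ℕ→ℚ ē ℚ.- n/2 ℚ.- m̂      ≡⟨ solve 3 (λ a b h → a :+ b :- h :- a := b :- h) refl m̂ (ℕ→ℚ ē) n/2 ⟩
  ℕ→ℚ ē ℚ.- n/2                  ∎)
  where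
  open ≡-Reasoning
  open +-*-Solver
  m ē : ℕ
  m = edges G
  ē = edges (complement G)
  m̂ n/2 : ℚ.ℚ
  m̂ = ℕ→ℚ m
  n/2 = ℤ.+ n ℚ./ 2

lemma2p2 : (n : ℕ) → n ≥ 2 → (G : Graph n) → 1 ≤ edges G → q*≤ G (bound G)
lemma2p2 n _ G 1≤m f = begin
  modularity G f
    ≤⟨ quotient-bound {{>-nonZero 1≤m}} (partition-inequality G f) ⟩
  ℕ→ℚ (2 * ē ∸ n) ℚ.* inv m
    ≤⟨ ℚP.*-monoʳ-≤-nonNeg (inv m) {{inv-nonNeg m}} (2e∸n≤2[e-n/2]⁺ ē n) ⟩
  ℕ→ℚ 2 ℚ.* ((ℕ→ℚ ē ℚ.- ℤ.+ n ℚ./ 2) ⁺) ℚ.* inv m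
    ≡⟨ bound≡2[ē-n/2]⁺/m G ⟨
  bound G
    ∎
  where
  open ℚP.≤-Reasoning
  m ē : ℕ
  m = edges G
  ē = edges (complement G)
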